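{- The following hold: (C1) $\neg\langle[G]\rangle\bot$ is valid for every $G\subseteq A$; (C2) $\langle[G]\rangle\top$ is valid for every $G\subseteq A$; (C3) $\neg\langle[\emptyset]\rangle\neg\varphi\to\langle[A]\rangle\varphi$ is valid for every formula $\varphi$; (C4) $\langle[G]\rangle(\varphi\wedge\psi)\to\langle[G]\rangle\varphi$ is valid for all $G$, $\varphi$, $\psi$; (C5) $\langle[G]\rangle\varphi\wedge\langle[H]\rangle\psi\to\langle[G\cup H]\rangle(\varphi\wedge\psi)$ is valid whenever $G,H\subseteq A$ with $G\cap H=\emptyset$; and (R1) if $\varphi\leftrightarrow\psi$ is valid then $\langle[G]\rangle\varphi\leftrightarrow\langle[G]\rangle\psi$ is valid. (Consequently every theorem of Coalition Logic, with its modality read as $\langle[G]\rangle$, is valid.)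
   Context: Fix a finite set $A$ of agents and a countable set $P$ of propositional variables. The language $\mathcal{L}_{CoRGAL}$ is given by $\varphi ::= p \mid \neg\varphi \mid (\varphi\wedge\varphi) \mid K_a\varphi \mid [\varphi]\varphi \mid [G,\varphi]\varphi \mid [\langle G\rangle]\varphi$ with $p\in P$, $a\in A$, $G\subseteq A$; $\langle\varphi\rangle\psi:=\neg[\varphi]\neg\psi$, $\langle[G]\rangle\varphi:=\neg[\langle G\rangle]\neg\varphi$. $\mathcal{L}_{EL}$ is the fragment built only from $p,\neg,\wedge,K_a$. For $G\subseteq A$, $\mathcal{L}_{EL}^G$ is the set of formulas $\bigwedge_{i\in G}K_i\varphi_i$ with each $\varphi_i\in\mathcal{L}_{EL}$; $\psi_G$ denotes an element of $\mathcal{L}_{EL}^G$, $\chi_{A\setminus G}$ one of $\mathcal{L}_{EL}^{A\setminus G}$. An epistemic model is $M=(W,\sim,V)$ with $W\neq\emptyset$, each $\sim_a$ an equivalence relation, $V:P\to\mathcal{P}(W)$. $M^\varphi$ is the restriction of $M$ to the states where $\varphi$ holds. Semantics: $p,\neg,\wedge$ as usual; $K_a\varphi$ true at $w$ iff $\varphi$ true at all $v\sim_a w$; $(M,w)\models[\varphi]\psi$ iff $(M,w)\models\varphi$ implies $(M^\varphi,w)\models\psi$; $(M,w)\models[G,\chi]\varphi$ iff $(M,w)\models\chi$ and for all $\psi_G$, $(M,w)\models[\psi_G\wedge\chi]\varphi$; $(M,w)\models[\langle G\rangle]\varphi$ iff for all $\psi_G$ there is $\chi_{A\setminus G}$ with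 $(M,w)\models\psi_G\to\langle\psi_G\wedge\chi_{A\setminus G}\rangle\varphi$. Equivalently, $(M,w)\models\langle[G]\rangle\varphi$ iff there is $\psi_G$ such that for all $\chi_{A\setminus G}$, $(M,w)\models\psi_G\wedge[\psi_G\wedge\chi_{A\setminus G}]\varphi$. Valid means true at every pointed model. Coalition Logic is axiomatised by propositional tautologies, C1–C5, modus ponens and rule R1 above. -}

module Defs where

open import Level using (0ℓ)
open import Data.Nat using (ℕ)
open import Data.Fin using (Fin)
open import Data.Fin.Subset as S using (Subset)
open import Data.Product using (Σ; ∃; _×_; _,_)
open import Data.Empty using () renaming (⊥ to Empty)
open import Relation.Binary.Structures using (IsEquivalence)
open import Relation.Binary.PropositionalEquality using (_≡_)

-- Agents: Fin n (a finite set A of n agents); propositional variables: ℕ.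
-- Coalitions G ⊆ A: Subset n.

data ELForm (n : ℕ) : Set where
  evar : ℕ → ELForm n
  eneg : ELForm n → ELForm n
  eand : ELForm n → ELForm n → ELForm n
  eK   : Fin n → ELForm n → ELForm n

data Form (n : ℕ) : Set where
  var   : ℕ → Form n
  neg   : Form n → Form n
  and   : Form n → Form n → Form n
  K     : Fin n → Form n → Form n
  ann   : Form n → Form n → Form n
  gann  : Subset n → Form n → Form n → Form n
  cann  : Subset n → Form n → Form n

record Model (n : ℕ) : Set₁ where
  field
    W     : Set
    R     : Fin n → W → W → Set
    equiv : (a : Fin n) → IsEquivalence (R a)
    V     : ℕ → W → Set
open Model public

restrict : {n : ℕ} (M : Model n) → (W M → Set) → Model n
restrict M P = record
  { W = Σ (W M) P
  ; R = λ a u v → R M a (u .Data.Product.proj₁) (v .Data.Product.proj₁)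
  ; equiv = λ a → record
      { refl = IsEquivalence.refl (equiv M a)
      ; sym = IsEquivalence.sym (equiv M a)
      ; trans = IsEquivalence.trans (equiv M a) }
  ; V = λ p u → V M p (u .Data.Product.proj₁)
  }

¬' : Set → Set
¬' X = X → Empty

satEL : {n : ℕ} (M : Model n) → ELForm n → W M → Set
satEL M (evar p) w = V M p w
satEL M (eneg φ) w = ¬' (satEL M φ w)
satEL M (eand φ ψ) w = satEL M φ w × satEL M ψ w
satEL M (eK a φ) w = ∀ v → R M a w v → satEL M φ v

-- A formula ψ_G ∈ L_EL^G, i.e. ⋀_{i∈G} K_i φ_i, is given by the family
-- (φ_i)_i : Fin n → ELForm n (only the components with i ∈ G matter).
-- Its truth at w:
satCoal : {n : ℕ} (M : Model n) → Subset n → (Fin n → ELForm n) → W M → Set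
satCoal M G f w = ∀ i → i S.∈ G → satEL M (eK i (f i)) w

sat : {n : ℕ} (M : Model n) → Form n → W M → Set
sat {n} M (var p) w = V M p w
sat {n} M (neg φ) w = ¬' (sat M φ w)
sat {n} M (and φ ψ) w = sat M φ w × sat M ψ w
sat {n} M (K a φ) w = ∀ v → R M a w v → sat M φ v
sat {n} M (ann φ ψ) w = (pf : sat M φ w) → sat (restrict M (sat M φ)) ψ (w , pf)
sat {n} M (gann G χ φ) w =
  sat M χ w ×
  ((f : Fin n → ELForm n) →
    let P = λ v → satCoal M G f v × sat M χ v in
    (pf : P w) → sat (restrict M P) φ (w , pf))
-- (M,w) ⊨ [⟨G⟩]φ iff for all ψ_G there is χ_{A∖G} with
--   (M,w) ⊨ ψ_G → ⟨ψ_G ∧ χ_{A∖G}⟩φ,  where ⟨θ⟩φ := ¬[θ]¬φ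
sat {n} M (cann G φ) w =
  (f : Fin n → ELForm n) → ∃ λ (g : Fin n → ELForm n) →
    let P = λ v → satCoal M G f v × satCoal M (S.∁ G) g v in
    satCoal M G f w →
      ¬' ((pf : P w) → ¬' (sat (restrict M P) φ (w , pf)))

infixr 4 _⇒_ _⇔_
infix 6 ⟪_⟫_
⊥f : {n : ℕ} → Form n
⊥f = and (var 0) (neg (var 0))

⊤f : {n : ℕ} → Form n
⊤f = neg ⊥f

_⇒_ : {n : ℕ} → Form n → Form n → Form n
φ ⇒ ψ = neg (and φ (neg ψ))

_⇔_ : {n : ℕ} → Form n → Form n → Form n
φ ⇔ ψ = and (φ ⇒ ψ) (ψ ⇒ φ)

⟪_⟫_ : {n : ℕ} → Subset n → Form n → Form n
⟪ G ⟫ φ = neg (cann G (neg φ))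

Valid : {n : ℕ} → Form n → Set₁
Valid {n} φ = (M : Model n) (w : W M) → sat M φ w

module Submission where

-- The proof rests on three general facts.
--  * Bisimulation invariance: truth of every CoRGAL formula is preserved by
--    bisimulations, and bisimulations survive restriction to matching
--    predicates.  Consequently announcing two pointwise-equivalent
--    predicates has the same effect (announce-cong).
--  * A strategic reading of ⟨[G]⟩: G can force φ at w when some true ψ_G
--    makes φ hold after announcing ψ_G ∧ χ, for every χ_{A∖G}.  Forcing
--    implies ⟨[G]⟩φ outright, and with excluded middle the converse holds.
--  * Coalition formulas only depend on the members of the coalition, so
--    strategies of disjoint coalitions can be merged and outcomes regrouped.
--
-- C4 and R1 follow constructively from monotonicity of ⟨[G]⟩ (rule RM);
-- C1 and C2 use the tautological strategy; C3 turns the χ_A supplied by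
-- ¬⟨[∅]⟩¬φ into a strategy of the grand coalition; C5 merges the forcing
-- strategies of two disjoint coalitions.  Only C3 and C5 use excluded
-- middle (as double negation elimination).

open import Defs
open import Level using (0ℓ)
open import Data.Nat using (ℕ)
open import Data.Fin using (Fin)
open import Data.Fin.Subset using (Subset; _∩_; _∪_; ∁; _∈_; _∉_; _⊆_)
open import Data.Fin.Subset as S using ()
open import Data.Fin.Subset.Properties
  using (_∈?_; ∉⊥; ∈⊤; x∈p∩q⁺; x∈p∪q⁻; p⊆p∪q; q⊆p∪q; ∪-comm;
         x∈p⇒x∉∁p; x∈∁p⇒x∉p; x∉p⇒x∈∁p; p⊆q⇒∁p⊇∁q)
open import Data.Product using (_×_; ∃; _,_; proj₁; proj₂; map₂; swap)
open import Data.Sum using (_⊎_; inj₁; inj₂; [_,_])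
open import Relation.Nullary using (¬_; yes; no)
open import Relation.Binary.PropositionalEquality using (_≡_; refl; sym; subst)
open import Data.Empty using (⊥-elim)
open import Axiom.ExcludedMiddle using (ExcludedMiddle)
open import Axiom.DoubleNegationElimination
  using (DoubleNegationElimination; em⇒dne)

variable
  n : ℕ
  A B C D : Set

record Iff (A B : Set) : Set where
  constructor mkIff
  field
    to   : A → B
    from : B → A
open Iff

iff-sym : Iff A B → Iff B A
iff-sym e = mkIff (from e) (to e)

iff-trans : Iff A B → Iff B C → Iff A C
iff-trans e e′ = mkIff (λ a → to e′ (to e a)) (λ c → from e (from e′ c))

iff-swap : Iff (A × B) (B × A)
iff-swap = mkIff swap swap

iff-regroup : {X Y Z T U : Set} →
  Iff X (Y × Z) → Iff U (Z × T) → Iff (X × T) (Y × U)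
iff-regroup X⇔Y∧Z U⇔Z∧T = mkIff
  (λ (x , t) → let (y , z) = to X⇔Y∧Z x in y , from U⇔Z∧T (z , t))
  (λ (y , u) → let (z , t) = to U⇔Z∧T u in from X⇔Y∧Z (y , z) , t)

iff-¬ : Iff A B → Iff (¬ A) (¬ B)
iff-¬ e = mkIff (λ ¬a b → ¬a (from e b)) (λ ¬b a → ¬b (to e a))

iff-× : Iff A B → Iff C D → Iff (A × C) (B × D)
iff-× e e′ = mkIff (λ (a , c) → to e a , to e′ c) (λ (b , d) → from e b , from e′ d)

iff-→ : Iff A B → Iff C D → Iff (A → C) (B → D)
iff-→ e e′ = mkIff (λ h b → to e′ (h (from e b))) (λ h a → from e′ (h (to e a)))

Box : (M : Model n) → (W M → Set) → Form n → W M → Set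
Box M P φ w = (pf : P w) → sat (restrict M P) φ (w , pf)

record Bisimulation (M M′ : Model n) (Z : W M → W M′ → Set) : Set where
  field
    atoms : ∀ {w w′} → Z w w′ → ∀ p → Iff (V M p w) (V M′ p w′)
    forth : ∀ {w w′ v} a → Z w w′ → R M a w v → ∃ λ v′ → R M′ a w′ v′ × Z v v′
    back  : ∀ {w w′ v′} a → Z w w′ → R M′ a w′ v′ → ∃ λ v → R M a w v × Z v v′
open Bisimulation

identity-bisimulation : (M : Model n) → Bisimulation M M _≡_
atoms (identity-bisimulation M) refl p = mkIff (λ x → x) (λ x → x)
forth (identity-bisimulation M) {v = v} a refl r = v , r , refl
back  (identity-bisimulation M) {v′ = v} a refl r = v , r , refl

restrict-bisimulation : {M M′ : Model n} {Z : W M → W M′ → Set} →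
  Bisimulation M M′ Z → {P : W M → Set} {P′ : W M′ → Set} →
  (∀ {w w′} → Z w w′ → Iff (P w) (P′ w′)) →
  Bisimulation (restrict M P) (restrict M′ P′) (λ u u′ → Z (proj₁ u) (proj₁ u′))
atoms (restrict-bisimulation B pres) z p = atoms B z p
forth (restrict-bisimulation B pres) {v = v , pv} a z r =
  let (v′ , r′ , z′) = forth B a z r in (v′ , to (pres z′) pv) , r′ , z′
back (restrict-bisimulation B pres) {v′ = v′ , pv′} a z r′ =
  let (v , r , z′) = back B a z r′ in (v , from (pres z′) pv′) , r , z′

module Invariance {M M′ : Model n} {Z : W M → W M′ → Set}
                  (B : Bisimulation M M′ Z) where

  knowledge-invariant : ∀ {P : W M → Set} {P′ : W M′ → Set} a →
    (∀ {v v′} → Z v v′ → Iff (P v) (P′ v′)) →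
    ∀ {w w′} → Z w w′ →
    Iff (∀ v → R M a w v → P v) (∀ v′ → R M′ a w′ v′ → P′ v′)
  knowledge-invariant a inv z = mkIff
    (λ h v′ r′ → let (v , r , z′) = back B a z r′ in to (inv z′) (h v r))
    (λ h v r → let (v′ , r′ , z′) = forth B a z r in from (inv z′) (h v′ r′))

  satEL-invariant : ∀ φ {w w′} → Z w w′ → Iff (satEL M φ w) (satEL M′ φ w′)
  satEL-invariant (evar p)   z = atoms B z p
  satEL-invariant (eneg φ)   z = iff-¬ (satEL-invariant φ z)
  satEL-invariant (eand φ ψ) z = iff-× (satEL-invariant φ z) (satEL-invariant ψ z)
  satEL-invariant (eK a φ)   z = knowledge-invariant a (satEL-invariant φ) z

  coal-invariant : ∀ G f {w w′} → Z w w′ →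
    Iff (satCoal M G f w) (satCoal M′ G f w′)
  coal-invariant G f z = mkIff
    (λ h i i∈G → to (satEL-invariant (eK i (f i)) z) (h i i∈G))
    (λ h i i∈G → from (satEL-invariant (eK i (f i)) z) (h i i∈G))

  box-invariant : ∀ {P : W M → Set} {P′ : W M′ → Set} φ →
    (pres : ∀ {w w′} → Z w w′ → Iff (P w) (P′ w′)) →
    (∀ {u u′} → Z (proj₁ u) (proj₁ u′) →
       Iff (sat (restrict M P) φ u) (sat (restrict M′ P′) φ u′)) →
    ∀ {w w′} → Z w w′ → Iff (Box M P φ w) (Box M′ P′ φ w′)
  box-invariant φ pres inv z = mkIff
    (λ h p′ → to (inv z) (h (from (pres z) p′)))
    (λ h p → from (inv z) (h (to (pres z) p)))

sat-invariant : {M M′ : Model n} {Z : W M → W M′ → Set} →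
  Bisimulation M M′ Z → ∀ φ {w w′} → Z w w′ → Iff (sat M φ w) (sat M′ φ w′)
sat-invariant B (var p)   z = atoms B z p
sat-invariant B (neg φ)   z = iff-¬ (sat-invariant B φ z)
sat-invariant B (and φ ψ) z = iff-× (sat-invariant B φ z) (sat-invariant B ψ z)
sat-invariant B (K a φ)   z =
  Invariance.knowledge-invariant B a (sat-invariant B φ) z
sat-invariant B (ann φ ψ) z =
  Invariance.box-invariant B ψ pres (sat-invariant (restrict-bisimulation B pres) ψ) z
  where pres = sat-invariant B φ
sat-invariant B (gann G χ φ) z = iff-× (sat-invariant B χ z) (mkIff
  (λ h f → to (announce f) (h f))
  (λ h f → from (announce f) (h f)))
  where
  pres = λ f {w} {w′} (z : _) →
    iff-× (Invariance.coal-invariant B G f {w} {w′} z) (sat-invariant B χ z)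
  announce = λ f → Invariance.box-invariant B φ (pres f)
    (sat-invariant (restrict-bisimulation B (pres f)) φ) z
sat-invariant B (cann G φ) z = mkIff
  (λ h f → map₂ (λ {g} → to (move f g)) (h f))
  (λ h f → map₂ (λ {g} → from (move f g)) (h f))
  where
  pres = λ f g {w} {w′} (z : _) → iff-× (Invariance.coal-invariant B G f {w} {w′} z)
                                        (Invariance.coal-invariant B (∁ G) g z)
  move = λ f g → iff-→ (Invariance.coal-invariant B G f z) (iff-¬
    (Invariance.box-invariant B (neg φ) (pres f g)
      (λ z′ → iff-¬ (sat-invariant (restrict-bisimulation B (pres f g)) φ z′)) z))

restrict-cong : (M : Model n) {P Q : W M → Set} → (∀ v → Iff (P v) (Q v)) →
  ∀ φ {w} (p : P w) (q : Q w) →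
  sat (restrict M P) φ (w , p) → sat (restrict M Q) φ (w , q)
restrict-cong M P⇔Q φ p q = to (sat-invariant
  (restrict-bisimulation (identity-bisimulation M) (λ { refl → P⇔Q _ })) φ refl)

announce-cong : (M : Model n) {P Q : W M → Set} → (∀ v → Iff (P v) (Q v)) →
  ∀ φ {w} → Box M P φ w → Box M Q φ w
announce-cong M P⇔Q φ box q = restrict-cong M P⇔Q φ (from (P⇔Q _) q) q (box _)

Disjoint : Subset n → Subset n → Set
Disjoint G H = ∀ {i} → i ∈ G → i ∉ H

∩≡⊥⇒disjoint : {G H : Subset n} → G ∩ H ≡ S.⊥ → Disjoint G H
∩≡⊥⇒disjoint G∩H≡⊥ i∈G i∈H =
  ∉⊥ (subst (_ ∈_) G∩H≡⊥ (x∈p∩q⁺ (i∈G , i∈H)))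

record DisjointUnion (X Y Z : Subset n) : Set where
  field
    disjoint : Disjoint Y Z
    split    : ∀ {i} → i ∈ X → i ∈ Y ⊎ i ∈ Z
    left     : Y ⊆ X
    right    : Z ⊆ X
open DisjointUnion

∪-disjointUnion : {G H : Subset n} → Disjoint G H → DisjointUnion (G ∪ H) G H
∪-disjointUnion {G = G} {H} G#H = record
  { disjoint = G#H ; split = x∈p∪q⁻ G H ; left = p⊆p∪q H ; right = q⊆p∪q G H }

∁-disjointUnion : {G H : Subset n} → Disjoint G H →
  DisjointUnion (∁ G) H (∁ (G ∪ H))
∁-disjointUnion {G = G} {H} G#H = record
  { disjoint = λ i∈H → x∈p⇒x∉∁p (q⊆p∪q G H i∈H)
  ; split    = split′
  ; left     = λ i∈H → x∉p⇒x∈∁p (λ i∈G → G#H i∈G i∈H)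
  ; right    = p⊆q⇒∁p⊇∁q (p⊆p∪q H)
  }
  where
  split′ : ∀ {i} → i ∈ ∁ G → i ∈ H ⊎ i ∈ ∁ (G ∪ H)
  split′ {i} i∈∁G with i ∈? H
  ... | yes i∈H = inj₁ i∈H
  ... | no  i∉H = inj₂ (x∉p⇒x∈∁p (λ i∈G∪H →
                    [ x∈∁p⇒x∉p i∈∁G , i∉H ] (x∈p∪q⁻ G H i∈G∪H)))

merge : Subset n → (Fin n → ELForm n) → (Fin n → ELForm n) → Fin n → ELForm n
merge G f g i with i ∈? G
... | yes _ = f i
... | no  _ = g i

merge-∈ : ∀ {G : Subset n} {f g i} → i ∈ G → merge G f g i ≡ f i
merge-∈ {G = G} {i = i} i∈G with i ∈? G
... | yes _   = refl
... | no  i∉G = ⊥-elim (i∉G i∈G)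

merge-∉ : ∀ {G : Subset n} {f g i} → i ∉ G → merge G f g i ≡ g i
merge-∉ {G = G} {i = i} i∉G with i ∈? G
... | yes i∈G = ⊥-elim (i∉G i∈G)
... | no  _   = refl

⊤EL : ELForm n
⊤EL = eneg (eand (evar 0) (eneg (evar 0)))

trivial : Fin n → ELForm n
trivial _ = ⊤EL

module Coalitions (M : Model n) where

  coal-⊆ : ∀ {G G′} f {v} → G′ ⊆ G → satCoal M G f v → satCoal M G′ f v
  coal-⊆ f G′⊆G c i i∈G′ = c i (G′⊆G i∈G′)

  coal-agree : ∀ {G} f g {v} → (∀ {i} → i ∈ G → f i ≡ g i) →
    satCoal M G f v → satCoal M G g v
  coal-agree f g {v} f≗g c i i∈G =
    subst (λ φ → satEL M (eK i φ) v) (f≗g i∈G) (c i i∈G)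

  coal-trivial : ∀ G {v} → satCoal M G trivial v
  coal-trivial G i i∈G u r (p , ¬p) = ¬p p

  coal-∅ : ∀ {f v} → satCoal M S.⊥ f v
  coal-∅ i i∈⊥ = ⊥-elim (∉⊥ i∈⊥)

  coal-merge : ∀ {X Y Z f g v} → DisjointUnion X Y Z →
    Iff (satCoal M X (merge Y f g) v) (satCoal M Y f v × satCoal M Z g v)
  coal-merge {Y = Y} {Z} {f} {g} X=Y⊎Z = mkIff
    (λ c → coal-agree h f on-Y (coal-⊆ h (left X=Y⊎Z) c)
         , coal-agree h g on-Z (coal-⊆ h (right X=Y⊎Z) c))
    (λ (cY , cZ) i i∈X →
       [ (λ i∈Y → coal-agree f h (λ i∈Y → sym (on-Y i∈Y)) cY i i∈Y)
       , (λ i∈Z → coal-agree g h (λ i∈Z → sym (on-Z i∈Z)) cZ i i∈Z)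
       ] (split X=Y⊎Z i∈X))
    where
    h = merge Y f g
    on-Y : ∀ {i} → i ∈ Y → h i ≡ f i
    on-Y = merge-∈
    on-Z : ∀ {i} → i ∈ Z → h i ≡ g i
    on-Z i∈Z = merge-∉ (λ i∈Y → disjoint X=Y⊎Z i∈Y i∈Z)

  Outcome : Subset n → (Fin n → ELForm n) → (Fin n → ELForm n) → W M → Set
  Outcome G f g v = satCoal M G f v × satCoal M (∁ G) g v

  outcome-∅ : ∀ {f g v} → Iff (Outcome S.⊥ f g v) (satCoal M S.⊤ g v)
  outcome-∅ {f} {g} = mkIff (λ (_ , c) → coal-⊆ g (λ _ → x∉p⇒x∈∁p ∉⊥) c)
                    (λ c → coal-∅ {f} , coal-⊆ g (λ _ → ∈⊤) c)

  outcome-A : ∀ {f g v} → Iff (Outcome S.⊤ f g v) (satCoal M S.⊤ f v)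
  outcome-A = mkIff proj₁ (λ c → c , λ i i∈∁⊤ → ⊥-elim (x∈∁p⇒x∉p i∈∁⊤ ∈⊤))

  record Forces (G : Subset n) (φ : Form n) (w : W M) : Set where
    constructor forcing
    field
      strategy : Fin n → ELForm n
      true-at  : satCoal M G strategy w
      wins     : ∀ g → Box M (Outcome G strategy g) φ w

  forces⇒⟪⟫ : ∀ G φ {w} → Forces G φ w → sat M (⟪ G ⟫ φ) w
  forces⇒⟪⟫ G φ (forcing f cf wins) c =
    let (g , r) = c f in r cf (λ pf ¬φ → ¬φ (wins g pf))

  module _ (dne : DoubleNegationElimination 0ℓ) where

    ¬∀⇒∃¬ : {X : Set} {P : X → Set} → ¬ (∀ x → P x) → ∃ λ x → ¬ P x
    ¬∀⇒∃¬ ¬∀ = dne λ ¬∃ → ¬∀ λ x → dne λ ¬Px → ¬∃ (x , ¬Px)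

    -- If no ψ_G forces φ, then each ψ_G has a response under which it fails,
    -- which is what [⟨G⟩]¬φ demands.  (Instantiating g := f below only serves
    -- to extract the g-independent truth of ψ_G.)
    ⟪⟫⇒forces : ∀ G φ {w} → sat M (⟪ G ⟫ φ) w → Forces G φ w
    ⟪⟫⇒forces G φ ⟪G⟫φ = dne λ ¬forces → ⟪G⟫φ λ f →
      let (g , ¬wins) = ¬∀⇒∃¬ (λ wins → ¬forces (forcing f (proj₁ (wins f)) λ g → proj₂ (wins g)))
      in g , λ cf ¬¬φ → ¬wins (cf , λ pf → dne (¬¬φ pf))

  -- Disjoint coalitions combine their forcing strategies: against any
  -- response g of the rest, the joint outcome is G's outcome against H's
  -- strategy plus g, and symmetrically for H.
  forces-∪ : ∀ {G H φ ψ w} → Disjoint G H → Forces G φ w → Forces H ψ w →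
    Forces (G ∪ H) (and φ ψ) w
  forces-∪ {G} {H} {φ} {ψ} G#H (forcing f₁ c₁ wins₁) (forcing f₂ c₂ wins₂) =
    forcing (merge G f₁ f₂) (from joint (c₁ , c₂)) λ g pf →
      announce-cong M (λ _ → iff-sym (regroup-G g)) φ (wins₁ (merge H f₂ g)) pf ,
      announce-cong M (λ _ → iff-sym (regroup-H g)) ψ (wins₂ (merge G f₁ g)) pf
    where
    joint : ∀ {v} → Iff (satCoal M (G ∪ H) (merge G f₁ f₂) v)
                        (satCoal M G f₁ v × satCoal M H f₂ v)
    joint = coal-merge (∪-disjointUnion G#H)

    ∁H-split : DisjointUnion (∁ H) G (∁ (G ∪ H))
    ∁H-split = subst (λ U → DisjointUnion (∁ H) G (∁ U)) (∪-comm H G)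
                     (∁-disjointUnion (λ i∈H i∈G → G#H i∈G i∈H))

    regroup-G : ∀ g {v} → Iff (Outcome (G ∪ H) (merge G f₁ f₂) g v)
                              (Outcome G f₁ (merge H f₂ g) v)
    regroup-G g = iff-regroup joint (coal-merge (∁-disjointUnion G#H))

    regroup-H : ∀ g {v} → Iff (Outcome (G ∪ H) (merge G f₁ f₂) g v)
                              (Outcome H f₂ (merge G f₁ g) v)
    regroup-H g = iff-regroup (iff-trans joint iff-swap) (coal-merge ∁H-split)

⟪⟫-mono : (G : Subset n) (φ ψ : Form n) → Valid (φ ⇒ ψ) → Valid (⟪ G ⟫ φ ⇒ ⟪ G ⟫ ψ)
⟪⟫-mono G φ ψ φ⇒ψ M w (⟪G⟫φ , ¬⟪G⟫ψ) = ¬⟪G⟫ψ λ c → ⟪G⟫φ λ f →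
  map₂ (λ r cf ¬¬φ → r cf (λ pf ¬ψ → ¬¬φ pf (λ φ′ → φ⇒ψ _ _ (φ′ , ¬ψ)))) (c f)

-- C1: the tautological response makes every ψ_G announceable at w, and ⊥
-- fails afterwards.
C1 : (G : Subset n) → Valid (neg (⟪ G ⟫ ⊥f))
C1 G M w ¬[⟨G⟩]⊤ = ¬[⟨G⟩]⊤ λ f →
  trivial , λ cf ¬¬⊥ → ¬¬⊥ (cf , coal-trivial (∁ G)) (λ (p , ¬p) → ¬p p)
  where open Coalitions M

-- C2: the tautological ψ_G forces ⊤.
C2 : (G : Subset n) → Valid (⟪ G ⟫ ⊤f)
C2 G M w = forces⇒⟪⟫ G ⊤f (forcing trivial (coal-trivial G) λ g pf (p , ¬p) → ¬p p)
  where open Coalitions M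

-- C3: ¬⟨[∅]⟩¬φ yields, for the empty ψ_∅, a χ_A that is true and after which
-- φ holds; as a strategy of the grand coalition it forces φ, since every
-- outcome of it is the announcement of χ_A itself.
C3 : DoubleNegationElimination 0ℓ → (φ : Form n) →
  Valid (neg (⟪ S.⊥ ⟫ (neg φ)) ⇒ ⟪ S.⊤ ⟫ φ)
C3 dne φ M w (¬¬[⟨∅⟩]φ , ¬⟪A⟫φ) =
  ¬⟪A⟫φ (forces⇒⟪⟫ S.⊤ φ (forcing g (to (outcome-∅ {trivial} {g} {w}) pf) λ g′ pf′ →
    restrict-cong M (same-outcome g′) φ pf pf′ φ-after))
  where
  open Coalitions M
  response = dne ¬¬[⟨∅⟩]φ trivial
  g = proj₁ response
  same-outcome : ∀ g′ v → Iff (Outcome S.⊥ trivial g v) (Outcome S.⊤ g g′ v)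
  same-outcome g′ v = iff-trans (outcome-∅ {trivial} {g} {v}) (iff-sym (outcome-A {g} {g′} {v}))
  announced : ∃ λ pf → sat (restrict M (Outcome S.⊥ trivial g)) φ (w , pf)
  announced = dne λ ¬∃ → proj₂ response (coal-∅ {trivial}) λ pf ¬¬φ → ¬¬φ λ φ′ → ¬∃ (pf , φ′)
  pf = proj₁ announced
  φ-after = proj₂ announced

C4 : (G : Subset n) (φ ψ : Form n) → Valid (⟪ G ⟫ (and φ ψ) ⇒ ⟪ G ⟫ φ)
C4 G φ ψ = ⟪⟫-mono G (and φ ψ) φ (λ M w ((φ′ , _) , ¬φ) → ¬φ φ′)

R1 : (G : Subset n) (φ ψ : Form n) → Valid (φ ⇔ ψ) → Valid (⟪ G ⟫ φ ⇔ ⟪ G ⟫ ψ)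
R1 G φ ψ φ⇔ψ M w = ⟪⟫-mono G φ ψ (λ M w → proj₁ (φ⇔ψ M w)) M w
                 , ⟪⟫-mono G ψ φ (λ M w → proj₂ (φ⇔ψ M w)) M w

-- C5: read both hypotheses as forcing strategies and merge them.
C5 : DoubleNegationElimination 0ℓ → (G H : Subset n) → G ∩ H ≡ S.⊥ →
  (φ ψ : Form n) → Valid (and (⟪ G ⟫ φ) (⟪ H ⟫ ψ) ⇒ ⟪ G ∪ H ⟫ (and φ ψ))
C5 dne G H G∩H≡⊥ φ ψ M w ((⟪G⟫φ , ⟪H⟫ψ) , ¬⟪G∪H⟫φ∧ψ) =
  ¬⟪G∪H⟫φ∧ψ (forces⇒⟪⟫ (G ∪ H) (and φ ψ) (forces-∪ (∩≡⊥⇒disjoint G∩H≡⊥)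
    (⟪⟫⇒forces dne G φ ⟪G⟫φ) (⟪⟫⇒forces dne H ψ ⟪H⟫ψ)))
  where open Coalitions M

proposition14 : ExcludedMiddle 0ℓ → {n : ℕ} →
    ((G : Subset n) → Valid (neg (⟪ G ⟫ ⊥f))) ×
    ((G : Subset n) → Valid (⟪ G ⟫ ⊤f)) ×
    ((φ : Form n) → Valid (neg (⟪ S.⊥ ⟫ (neg φ)) ⇒ ⟪ S.⊤ ⟫ φ)) ×
    ((G : Subset n) (φ ψ : Form n) → Valid (⟪ G ⟫ (and φ ψ) ⇒ ⟪ G ⟫ φ)) ×
    ((G H : Subset n) → G ∩ H ≡ S.⊥ → (φ ψ : Form n) →
    Valid (and (⟪ G ⟫ φ) (⟪ H ⟫ ψ) ⇒ ⟪ G ∪ H ⟫ (and φ ψ))) ×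
    ((G : Subset n) (φ ψ : Form n) → Valid (φ ⇔ ψ) → Valid (⟪ G ⟫ φ ⇔ ⟪ G ⟫ ψ))
proposition14 lem = C1 , C2 , C3 dne , C4 , C5 dne , R1
  where dne = em⇒dne lem
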